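{- Let $r\ge1$, $n\ge2$. For $w=x_1x_2\cdots x_n$ a nonincreasing word with letters in $\{0,\dots,r-1\}$ and $1\le i\le n-1$, define $$h=x_{i+1}\,(x_1+1)(x_2+1)\cdots(x_i+1)\,x_{i+2}x_{i+3}\cdots x_n.$$ Then $(w,i)\mapsto h$ is a bijection from $D_n(r)$ onto $H_n(r)$ satisfying $\mathrm{rinv}\,h=i$ and $\mathrm{tot}\,h=\mathrm{tot}\,w+i$.
   Context: $D_n(r)$ is the set of pairs $(w,i)$ with $w$ a nonincreasing word of length $n$ over $\{0,\dots,r-1\}$ and $1\le i\le n-1$. An $H$-word is a word $x_1\cdots x_n$ of nonnegative integers with $n\ge2$, $x_1<x_2$, and either $n=2$ or $x_2\ge x_3\ge\cdots\ge x_n$; $H_n(r)$ is the set of $H$-words of length $n$ with letters at most $r$. $\mathrm{tot}$ is the sum of letters; $\mathrm{inv}$ of a word is the number of pairs of positions $a<b$ with $x_a>x_b$, and $\mathrm{rinv}\,h=\mathrm{inv}$ of the reverse word of $h$. -}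

module Defs where

open import Data.Nat using (ℕ; zero; suc; _+_; _≤_; _<_; _≥_; _∸_; _<?_)
open import Data.Nat.ListAction using (sum)
open import Data.List using (List; []; _∷_; length; map; reverse; take; drop; _++_)
open import Relation.Nullary using (yes; no)
open import Relation.Binary.PropositionalEquality using (_≡_)
open import Data.List.Relation.Unary.All using (All)
open import Data.Product using (_×_)
open import Data.Unit using (⊤)
open import Data.Empty using (⊥)

Nonincreasing : List ℕ → Set
Nonincreasing [] = ⊤
Nonincreasing (x ∷ []) = ⊤
Nonincreasing (x ∷ y ∷ ys) = x ≥ y × Nonincreasing (y ∷ ys)

InD : ℕ → ℕ → List ℕ → ℕ → Set
InD n r w i = length w ≡ n × Nonincreasing w × All (λ x → x < r) w × 1 ≤ i × i ≤ n ∸ 1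

IsHWord : List ℕ → Set
IsHWord [] = ⊥
IsHWord (x ∷ []) = ⊥
IsHWord (x₁ ∷ x₂ ∷ xs) = x₁ < x₂ × Nonincreasing (x₂ ∷ xs)

InH : ℕ → ℕ → List ℕ → Set
InH n r h = length h ≡ n × IsHWord h × All (λ x → x ≤ r) h

tot : List ℕ → ℕ
tot = sum

countLess : ℕ → List ℕ → ℕ
countLess x [] = 0
countLess x (y ∷ ys) with y <? x
... | yes _ = suc (countLess x ys)
... | no _ = countLess x ys

inv : List ℕ → ℕ
inv [] = 0
inv (x ∷ xs) = countLess x xs + inv xs

rinv : List ℕ → ℕ
rinv h = inv (reverse h)

phi : List ℕ → ℕ → List ℕ
phi w i with drop i w
... | [] = map suc (take i w)
... | y ∷ rest = y ∷ (map suc (take i w) ++ rest)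

module Submission where

-- Cut w = p ++ y ∷ rest with |p| = i, so that phi w i = y ∷ map suc p ++ rest. As w is
-- nonincreasing, the letters of p are ≥ y ≥ the letters of rest; hence the raised letters
-- are exactly the letters of h above its first letter y, the tail of h is nonincreasing, and
-- rinv h counts the raised letters, i.e. equals i, while tot grows by one per raised letter.
-- Since i = rinv h is recovered from h, and the cut at i can be undone, phi is injective;
-- an H-word y ∷ t is hit by cutting t after its longest prefix of letters above y.

open import Defs
open import Data.Nat using (ℕ; zero; suc; pred; _+_; _≤_; _≥_; _<_; _∸_; _<?_; z≤n; s≤s)
open import Data.Nat.Properties
  using (≤-refl; ≤-trans; ≤-reflexive; ≤-pred; <⇒≤; <⇒≱; ≮⇒≥; ≤-<-trans; m≤n⇒m≤1+n; +-comm; +-identityʳ; +-commutativeSemigroup)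
open import Data.Nat.Solver using (module +-*-Solver)
open import Data.Nat.ListAction using (sum)
open import Data.Nat.ListAction.Properties using (sum-++)
open import Data.List using (List; []; _∷_; _++_; _∷ʳ_; [_]; map; length; reverse; take; drop)
open import Data.List.Properties using (unfold-reverse; length-map; length-++-≤ˡ; map-∘; map-id)
open import Data.List.Relation.Unary.All as All using (All; []; _∷_)
open import Data.List.Relation.Unary.All.Properties using (++⁺; ++⁻; ++⁻ˡ; map⁺; map⁻)
open import Data.Product using (_×_; ∃-syntax; _,_)
open import Data.Unit using (tt)
open import Data.Empty using (⊥-elim)
open import Relation.Nullary using (yes; no)
open import Relation.Binary.PropositionalEquality using (_≡_; refl; sym; trans; cong; cong₂; module ≡-Reasoning)
open import Algebra.Properties.CommutativeSemigroup +-commutativeSemigroup using (interchange)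

private
  variable
    a b i i′ n r x y : ℕ
    rest w w′ xs ys : List ℕ

countGreater : ℕ → List ℕ → ℕ
countGreater y [] = 0
countGreater y (x ∷ xs) with y <? x
... | yes _ = suc (countGreater y xs)
... | no  _ = countGreater y xs

countLess-++ : ∀ x xs ys → countLess x (xs ++ ys) ≡ countLess x xs + countLess x ys
countLess-++ x []       ys = refl
countLess-++ x (z ∷ xs) ys with z <? x
... | yes _ = cong suc (countLess-++ x xs ys)
... | no  _ = countLess-++ x xs ys

countGreater-++ : ∀ y xs ys → countGreater y (xs ++ ys) ≡ countGreater y xs + countGreater y ys
countGreater-++ y []       ys = refl
countGreater-++ y (x ∷ xs) ys with y <? x
... | yes _ = cong suc (countGreater-++ y xs ys)
... | no  _ = countGreater-++ y xs ys

countGreater-∷ : ∀ y x xs → countGreater y (x ∷ xs) ≡ countLess x [ y ] + countGreater y xs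
countGreater-∷ y x xs with y <? x
... | yes _ = refl
... | no  _ = refl

countGreater-reverse : ∀ y xs → countGreater y (reverse xs) ≡ countGreater y xs
countGreater-reverse y []       = refl
countGreater-reverse y (x ∷ xs) = begin
  countGreater y (reverse (x ∷ xs))               ≡⟨ cong (countGreater y) (unfold-reverse x xs) ⟩
  countGreater y (reverse xs ∷ʳ x)                ≡⟨ countGreater-++ y (reverse xs) [ x ] ⟩
  countGreater y (reverse xs) + countGreater y [ x ] ≡⟨ cong (_+ countGreater y [ x ]) (countGreater-reverse y xs) ⟩
  countGreater y xs + countGreater y [ x ]        ≡⟨ +-comm (countGreater y xs) _ ⟩
  countGreater y [ x ] + countGreater y xs        ≡⟨ countGreater-++ y [ x ] xs ⟨
  countGreater y (x ∷ xs)                         ∎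
  where open ≡-Reasoning

countGreater-≡0 : All (_≤ y) xs → countGreater y xs ≡ 0
countGreater-≡0 []                        = refl
countGreater-≡0 {y} {x ∷ _} (x≤y ∷ xs≤y) with y <? x
... | yes y<x = ⊥-elim (<⇒≱ y<x x≤y)
... | no  _   = countGreater-≡0 xs≤y

countGreater-≡length : All (y <_) xs → countGreater y xs ≡ length xs
countGreater-≡length []                        = refl
countGreater-≡length {y} {x ∷ _} (y<x ∷ y<xs) with y <? x
... | yes _   = cong suc (countGreater-≡length y<xs)
... | no  y≮x = ⊥-elim (y≮x y<x)

inv-∷ʳ : ∀ xs y → inv (xs ∷ʳ y) ≡ inv xs + countGreater y xs
inv-∷ʳ []       y = refl
inv-∷ʳ (x ∷ xs) y = begin
  countLess x (xs ∷ʳ y) + inv (xs ∷ʳ y)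
    ≡⟨ cong₂ _+_ (countLess-++ x xs [ y ]) (inv-∷ʳ xs y) ⟩
  (countLess x xs + countLess x [ y ]) + (inv xs + countGreater y xs)
    ≡⟨ interchange (countLess x xs) _ _ _ ⟩
  (countLess x xs + inv xs) + (countLess x [ y ] + countGreater y xs)
    ≡⟨ cong (countLess x xs + inv xs +_) (countGreater-∷ y x xs) ⟨
  inv (x ∷ xs) + countGreater y (x ∷ xs) ∎
  where open ≡-Reasoning

rinv-∷ : ∀ y xs → rinv (y ∷ xs) ≡ rinv xs + countGreater y xs
rinv-∷ y xs = begin
  inv (reverse (y ∷ xs))                          ≡⟨ cong inv (unfold-reverse y xs) ⟩
  inv (reverse xs ∷ʳ y)                           ≡⟨ inv-∷ʳ (reverse xs) y ⟩
  rinv xs + countGreater y (reverse xs)           ≡⟨ cong (rinv xs +_) (countGreater-reverse y xs) ⟩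
  rinv xs + countGreater y xs                     ∎
  where open ≡-Reasoning

Nonincreasing-tail : Nonincreasing (x ∷ xs) → Nonincreasing xs
Nonincreasing-tail {xs = []}    _          = tt
Nonincreasing-tail {xs = _ ∷ _} (_ , decr) = decr

Nonincreasing-∷⁻ : Nonincreasing (a ∷ xs) → All (_≤ a) xs
Nonincreasing-∷⁻ {xs = []}     _            = []
Nonincreasing-∷⁻ {xs = b ∷ xs} (b≤a , decr) = b≤a ∷ All.map (λ x≤b → ≤-trans x≤b b≤a) (Nonincreasing-∷⁻ decr)

Nonincreasing-∷⁺ : All (_≤ a) xs → Nonincreasing xs → Nonincreasing (a ∷ xs)
Nonincreasing-∷⁺ []        _    = tt
Nonincreasing-∷⁺ (b≤a ∷ _) decr = b≤a , decr

Nonincreasing-map : ∀ {f : ℕ → ℕ} → (∀ {m k} → m ≤ k → f m ≤ f k) →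
  Nonincreasing xs → Nonincreasing (map f xs)
Nonincreasing-map {xs = []}        f-mono _            = tt
Nonincreasing-map {xs = _ ∷ []}    f-mono _            = tt
Nonincreasing-map {xs = _ ∷ _ ∷ _} f-mono (b≤a , decr) = f-mono b≤a , Nonincreasing-map f-mono decr

Nonincreasing-++⁺ : ∀ xs → Nonincreasing xs → All (y ≤_) xs → Nonincreasing (y ∷ ys) →
  Nonincreasing (xs ++ ys)
Nonincreasing-++⁺ []                          _            _          decr         = Nonincreasing-tail decr
Nonincreasing-++⁺ {ys = []}    (a ∷ [])     _            _          _            = tt
Nonincreasing-++⁺ {ys = _ ∷ _} (a ∷ [])     _            (y≤a ∷ _)  (b≤y , decr) = ≤-trans b≤y y≤a , decr
Nonincreasing-++⁺              (a ∷ b ∷ xs) (b≤a , decr) (_ ∷ y≤xs) decr′        =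
  b≤a , Nonincreasing-++⁺ (b ∷ xs) decr y≤xs decr′

Nonincreasing-++-∷⁻ : ∀ xs → Nonincreasing (xs ++ y ∷ ys) →
  Nonincreasing xs × All (y ≤_) xs × Nonincreasing (y ∷ ys)
Nonincreasing-++-∷⁻ []           decr         = tt , [] , decr
Nonincreasing-++-∷⁻ (a ∷ [])     (y≤a , decr) = tt , y≤a ∷ [] , decr
Nonincreasing-++-∷⁻ (a ∷ b ∷ xs) (b≤a , decr) with Nonincreasing-++-∷⁻ (b ∷ xs) decr
... | decr′ , y≤b ∷ y≤xs , decr″ = (b≤a , decr′) , ≤-trans y≤b b≤a ∷ y≤b ∷ y≤xs , decr″

rinv-Nonincreasing : Nonincreasing xs → rinv xs ≡ 0
rinv-Nonincreasing {[]}     _    = refl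
rinv-Nonincreasing {a ∷ xs} decr = begin
  rinv (a ∷ xs)                    ≡⟨ rinv-∷ a xs ⟩
  rinv xs + countGreater a xs      ≡⟨ cong₂ _+_ (rinv-Nonincreasing (Nonincreasing-tail decr))
                                                (countGreater-≡0 (Nonincreasing-∷⁻ decr)) ⟩
  0                                ∎
  where open ≡-Reasoning

take-++-≡length : ∀ (xs ys : List ℕ) {i} → length xs ≡ i → take i (xs ++ ys) ≡ xs
take-++-≡length []       ys refl = refl
take-++-≡length (x ∷ xs) ys refl = cong (x ∷_) (take-++-≡length xs ys refl)

drop-++-≡length : ∀ (xs ys : List ℕ) {i} → length xs ≡ i → drop i (xs ++ ys) ≡ ys
drop-++-≡length []       ys refl = refl
drop-++-≡length (x ∷ xs) ys refl = drop-++-≡length xs ys refl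

cut-at : ∀ i (w : List ℕ) → i < length w → ∃[ p ] ∃[ y ] ∃[ rest ] (w ≡ p ++ y ∷ rest × length p ≡ i)
cut-at zero    (y ∷ rest) _         = [] , y , rest , refl , refl
cut-at (suc i) (x ∷ w)    (s≤s i<w) with cut-at i w i<w
... | p , y , rest , refl , refl = x ∷ p , y , rest , refl , refl

phi-drop : ∀ w i → drop i w ≡ y ∷ rest → phi w i ≡ y ∷ map suc (take i w) ++ rest
phi-drop w i eq with drop i w | eq
... | _ | refl = refl

phi-cut : ∀ p y (rest : List ℕ) → phi (p ++ y ∷ rest) (length p) ≡ y ∷ map suc p ++ rest
phi-cut p y rest = trans (phi-drop (p ++ y ∷ rest) (length p) (drop-++-≡length p (y ∷ rest) refl))
  (cong (λ q → y ∷ map suc q ++ rest) (take-++-≡length p (y ∷ rest) refl))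

length-phi-cut : ∀ p y (rest : List ℕ) → length (y ∷ map suc p ++ rest) ≡ length (p ++ y ∷ rest)
length-phi-cut []      y rest = refl
length-phi-cut (x ∷ p) y rest = cong suc (length-phi-cut p y rest)

All-phi-cut : ∀ p → All (_< r) (p ++ y ∷ rest) → All (_≤ r) (y ∷ map suc p ++ rest)
All-phi-cut p bound with ++⁻ p bound
... | p<r , y<r ∷ rest<r = <⇒≤ y<r ∷ ++⁺ (map⁺ p<r) (All.map <⇒≤ rest<r)

Nonincreasing-phi-cut : ∀ p → Nonincreasing (p ++ y ∷ rest) → Nonincreasing (map suc p ++ rest)
Nonincreasing-phi-cut p decr with Nonincreasing-++-∷⁻ p decr
... | decr-p , y≤p , decr-rest =
  Nonincreasing-++⁺ (map suc p) (Nonincreasing-map s≤s decr-p) (map⁺ (All.map m≤n⇒m≤1+n y≤p)) decr-rest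

IsHWord-phi-cut : ∀ a p → Nonincreasing (a ∷ p ++ y ∷ rest) → IsHWord (y ∷ map suc (a ∷ p) ++ rest)
IsHWord-phi-cut a p decr with Nonincreasing-++-∷⁻ (a ∷ p) decr
... | _ , y≤a ∷ _ , _ = s≤s y≤a , Nonincreasing-phi-cut (a ∷ p) decr

rinv-phi-cut : ∀ p → Nonincreasing (p ++ y ∷ rest) → rinv (y ∷ map suc p ++ rest) ≡ length p
rinv-phi-cut {y} {rest} p decr with Nonincreasing-++-∷⁻ p decr
... | _ , y≤p , decr-rest = begin
  rinv (y ∷ map suc p ++ rest)
    ≡⟨ rinv-∷ y (map suc p ++ rest) ⟩
  rinv (map suc p ++ rest) + countGreater y (map suc p ++ rest)
    ≡⟨ cong₂ _+_ (rinv-Nonincreasing (Nonincreasing-phi-cut p decr)) (countGreater-++ y (map suc p) rest) ⟩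
  countGreater y (map suc p) + countGreater y rest
    ≡⟨ cong₂ _+_ (countGreater-≡length (map⁺ (All.map s≤s y≤p))) (countGreater-≡0 (Nonincreasing-∷⁻ decr-rest)) ⟩
  length (map suc p) + 0
    ≡⟨ +-identityʳ _ ⟩
  length (map suc p)
    ≡⟨ length-map suc p ⟩
  length p ∎
  where open ≡-Reasoning

sum-map-suc : ∀ xs → sum (map suc xs) ≡ sum xs + length xs
sum-map-suc []       = refl
sum-map-suc (x ∷ xs) = begin
  suc x + sum (map suc xs)     ≡⟨ cong (suc x +_) (sum-map-suc xs) ⟩
  suc x + (sum xs + length xs) ≡⟨ solve 3 (λ x s l → con 1 :+ x :+ (s :+ l) := x :+ s :+ (con 1 :+ l)) refl
                                    x (sum xs) (length xs) ⟩
  x + sum xs + suc (length xs) ∎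
  where
  open ≡-Reasoning
  open +-*-Solver

tot-phi-cut : ∀ p y rest → tot (y ∷ map suc p ++ rest) ≡ tot (p ++ y ∷ rest) + length p
tot-phi-cut p y rest = begin
  y + sum (map suc p ++ rest)         ≡⟨ cong (y +_) (sum-++ (map suc p) rest) ⟩
  y + (sum (map suc p) + sum rest)    ≡⟨ cong (λ s → y + (s + sum rest)) (sum-map-suc p) ⟩
  y + ((sum p + length p) + sum rest) ≡⟨ solve 4 (λ y s l t → y :+ ((s :+ l) :+ t) := (s :+ (y :+ t)) :+ l) refl
                                           y (sum p) (length p) (sum rest) ⟩
  (sum p + (y + sum rest)) + length p ≡⟨ cong (_+ length p) (sum-++ p (y ∷ rest)) ⟨
  sum (p ++ y ∷ rest) + length p      ∎
  where
  open ≡-Reasoning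
  open +-*-Solver

≤∸1⇒< : 1 ≤ i → i ≤ n ∸ 1 → i < n
≤∸1⇒< {n = zero}  () z≤n
≤∸1⇒< {n = suc n} _  i≤n = s≤s i≤n

InD⇒<length : InD n r w i → i < length w
InD⇒<length (refl , _ , _ , 1≤i , i≤n∸1) = ≤∸1⇒< 1≤i i≤n∸1

phi-InD : InD n r w i → InH n r (phi w i) × rinv (phi w i) ≡ i × tot (phi w i) ≡ tot w + i
phi-InD {w = w} {i = i} d@(refl , decr , bound , 1≤i , _) with cut-at i w (InD⇒<length d)
... | [] , _ , _ , refl , refl = ⊥-elim (<⇒≱ 1≤i z≤n)
... | a ∷ p , y , rest , refl , refl rewrite phi-cut (a ∷ p) y rest =
  (length-phi-cut (a ∷ p) y rest , IsHWord-phi-cut a p decr , All-phi-cut (a ∷ p) bound) ,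
  rinv-phi-cut (a ∷ p) decr , tot-phi-cut (a ∷ p) y rest

unphi : List ℕ → ℕ → List ℕ
unphi []      _ = []
unphi (y ∷ t) i = map pred (take i t) ++ y ∷ drop i t

unphi-phi-cut : ∀ p y (rest : List ℕ) → unphi (y ∷ map suc p ++ rest) (length p) ≡ p ++ y ∷ rest
unphi-phi-cut p y rest = cong₂ (λ q rest′ → q ++ y ∷ rest′) unlift (drop-++-≡length (map suc p) rest (length-map suc p))
  where
  open ≡-Reasoning
  unlift : map pred (take (length p) (map suc p ++ rest)) ≡ p
  unlift = begin
    map pred (take (length p) (map suc p ++ rest)) ≡⟨ cong (map pred) (take-++-≡length (map suc p) rest (length-map suc p)) ⟩
    map pred (map suc p)                           ≡⟨ map-∘ p ⟨
    map (λ x → x) p                                ≡⟨ map-id p ⟩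
    p                                              ∎

unphi-phi : InD n r w i → unphi (phi w i) i ≡ w
unphi-phi {w = w} {i = i} d with cut-at i w (InD⇒<length d)
... | p , y , rest , refl , refl = trans (cong (λ h → unphi h (length p)) (phi-cut p y rest)) (unphi-phi-cut p y rest)

phi-injective : InD n r w i → InD n r w′ i′ → phi w i ≡ phi w′ i′ → w ≡ w′ × i ≡ i′
phi-injective {w = w} {i = i} {w′ = w′} {i′ = i′} d d′ eq = w≡w′ , i≡i′
  where
  open ≡-Reasoning
  i≡i′ : i ≡ i′
  i≡i′ = let (_ , rinv≡i , _) = phi-InD d ; (_ , rinv≡i′ , _) = phi-InD d′ in begin
    i                ≡⟨ rinv≡i ⟨
    rinv (phi w i)   ≡⟨ cong rinv eq ⟩
    rinv (phi w′ i′) ≡⟨ rinv≡i′ ⟩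
    i′               ∎
  w≡w′ : w ≡ w′
  w≡w′ = begin
    w                       ≡⟨ unphi-phi d ⟨
    unphi (phi w i) i       ≡⟨ cong₂ unphi eq i≡i′ ⟩
    unphi (phi w′ i′) i′    ≡⟨ unphi-phi d′ ⟩
    w′                      ∎

split-above : ∀ y t → Nonincreasing t →
  ∃[ p ] ∃[ rest ] (t ≡ map suc p ++ rest × All (y ≤_) p × Nonincreasing p × Nonincreasing (y ∷ rest))
split-above y []      _    = [] , [] , refl , [] , tt , tt
split-above y (a ∷ t) decr with y <? a
... | no y≮a = [] , a ∷ t , refl , [] , tt , ≮⇒≥ y≮a , decr
split-above y (suc a ∷ t) decr | yes (s≤s y≤a) with split-above y t (Nonincreasing-tail decr)
... | p , rest , refl , y≤p , decr-p , decr-rest =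
  a ∷ p , rest , refl , y≤a ∷ y≤p , Nonincreasing-∷⁺ p≤a decr-p , decr-rest
  where
  p≤a : All (_≤ a) p
  p≤a = All.map ≤-pred (map⁻ (++⁻ˡ (map suc p) (Nonincreasing-∷⁻ decr)))

All-unphi-cut : ∀ p → y ≤ b → Nonincreasing (y ∷ rest) →
  All (_≤ r) (map suc (b ∷ p) ++ rest) → All (_< r) ((b ∷ p) ++ y ∷ rest)
All-unphi-cut p y≤b decr-rest bound =
  ++⁺ b∷p<r (y<r ∷ All.map (λ x≤y → ≤-<-trans x≤y y<r) (Nonincreasing-∷⁻ decr-rest))
  where
  b∷p<r = map⁻ (++⁻ˡ (map suc (_ ∷ p)) bound)
  y<r   = ≤-<-trans y≤b (All.head b∷p<r)

phi-surjective : ∀ h → InH n r h → ∃[ w ] ∃[ i ] (InD n r w i × phi w i ≡ h)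
phi-surjective (y ∷ a ∷ t) (refl , (y<a , decr) , _ ∷ bound) with split-above y (a ∷ t) decr
... | [] , _ , refl , _ , _ , (a≤y , _) = ⊥-elim (<⇒≱ y<a a≤y)
... | b ∷ p , rest , refl , y≤b∷p , decr-p , decr-rest =
  (b ∷ p) ++ y ∷ rest , length (b ∷ p) ,
  ( sym (length-phi-cut (b ∷ p) y rest)
  , Nonincreasing-++⁺ (b ∷ p) decr-p y≤b∷p (≤-refl , decr-rest)
  , All-unphi-cut p (All.head y≤b∷p) decr-rest bound
  , s≤s z≤n
  , s≤s (≤-trans (≤-reflexive (sym (length-map suc p))) (length-++-≤ˡ (map suc p))) ) ,
  phi-cut (b ∷ p) y rest

proposition4p1 : (r n : ℕ) → r ≥ 1 → n ≥ 2 →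
    -- maps D_n(r) into H_n(r), with rinv h = i and tot h = tot w + i
    ((w : List ℕ) (i : ℕ) → InD n r w i →
      InH n r (phi w i) × rinv (phi w i) ≡ i × tot (phi w i) ≡ tot w + i)
    -- injective on D_n(r)
    × ((w w′ : List ℕ) (i i′ : ℕ) → InD n r w i → InD n r w′ i′ →
        phi w i ≡ phi w′ i′ → (w ≡ w′ × i ≡ i′))
    -- surjective onto H_n(r)
    × ((h : List ℕ) → InH n r h → ∃[ w ] ∃[ i ] (InD n r w i × phi w i ≡ h))
proposition4p1 r n _ _ = (λ _ _ → phi-InD) , (λ _ _ _ _ → phi-injective) , phi-surjective
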